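{- Let $G$ be a finite abelian group of order $n$, let $s$ be a positive integer, and let $H$ be a subgroup of $G$ of index $d>1$ such that the quotient $G/H$ is of type $(d_1,\dots,d_t)$. For each $i=1,\dots,t$ let $c_i$ be a positive integer with $c_i\le d_i-1$, and suppose that $$\sum_{i=1}^t \left\lceil \frac{d_i-1}{c_i}\right\rceil \ge s+1.$$ Then $$\widehat{\chi}(G,[0,s]) \ge \left(1+\sum_{i=1}^t c_i\right)\cdot\frac{n}{d}+1.$$
   Context: Groups are written additively. A finite abelian group $K$ is of type $(d_1,\dots,d_t)$ if $t$ and $d_1,\dots,d_t$ are positive integers with $d_1\ge 2$, $d_i$ divides $d_{i+1}$ for $i=1,\dots,t-1$, and $K\cong \mathbb{Z}_{d_1}\times\cdots\times\mathbb{Z}_{d_t}$ (every nontrivial finite abelian group has a unique type). For a nonempty subset $A$ of $G$ and a positive integer $h$, $hA$ is the set of all sums of $h$ not-necessarily-distinct elements of $A$; $0A=\{0\}$, and $[0,s]A=\bigcup_{h=0}^{s} hA$. $\langle A\rangle$ denotes the subgroup generated by $A$. Define $$\widehat{\chi}(G,[0,s])=\min\{m : \text{for every } A\subseteq G \text{ with } \langle A\rangle=G \text{ and } |A|\ge m,\ [0,s]A=G\}.$$ -}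

module Defs where

open import Level using (0ℓ)
open import Data.Nat using (ℕ; zero; suc; _+_; _*_; _∸_; _≤_; _<_; _/_; _%_)
open import Data.Fin using (Fin)
open import Data.List using (List; []; _∷_; length; foldr; map; allFin)
open import Data.Nat.ListAction using (sum)
open import Data.List.Membership.Propositional using (_∈_)
open import Data.List.Relation.Unary.All using (All)
open import Data.List.Relation.Unary.Unique.Propositional using (Unique)
open import Data.Product using (Σ; ∃; ∃-syntax; _×_)
open import Relation.Binary.PropositionalEquality using (_≡_)
open import Relation.Nullary using (Dec)
open import Algebra.Structures using (IsAbelianGroup)

record FiniteAbelianGroup : Set₁ where
  infixl 6 _+ᴳ_
  field
    Carrier        : Set
    _+ᴳ_           : Carrier → Carrier → Carrier
    0ᴳ             : Carrier
    -ᴳ_            : Carrier → Carrier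
    isAbelianGroup : IsAbelianGroup (_≡_ {A = Carrier}) _+ᴳ_ 0ᴳ -ᴳ_
    _≟ᴳ_           : (x y : Carrier) → Dec (x ≡ y)
    elements       : List Carrier
    elements-uniq  : Unique elements
    elements-compl : (x : Carrier) → x ∈ elements

  order : ℕ
  order = length elements

  sumᴳ : List Carrier → Carrier
  sumᴳ = foldr _+ᴳ_ 0ᴳ

  -- Subsets of G are represented by duplicate-free lists; |A| = length A.

  -- g ∈ hA : g is a sum of h (not necessarily distinct) elements of A
  -- (0A = {0}: the empty sum).
  InSumset : ℕ → List Carrier → Carrier → Set
  InSumset h A g = Σ (List Carrier) λ L → length L ≡ h × All (_∈ A) L × sumᴳ L ≡ g

  InRestrictedSumset : ℕ → List Carrier → Carrier → Set
  InRestrictedSumset s A g = ∃[ h ] (h ≤ s × InSumset h A g)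

  data InGenerated (A : List Carrier) : Carrier → Set where
    gen  : ∀ {x} → x ∈ A → InGenerated A x
    gen0 : InGenerated A 0ᴳ
    gen+ : ∀ {x y} → InGenerated A x → InGenerated A y → InGenerated A (x +ᴳ y)
    gen- : ∀ {x} → InGenerated A x → InGenerated A (-ᴳ x)

  Generates : List Carrier → Set
  Generates A = (g : Carrier) → InGenerated A g

  -- m belongs to the set whose minimum is χ̂(G,[0,s]):
  -- every A ⊆ G with ⟨A⟩ = G and |A| ≥ m satisfies [0,s]A = G.
  ChiHatProperty : ℕ → ℕ → Set
  ChiHatProperty s m =
    (A : List Carrier) → Unique A → Generates A → m ≤ length A →
    (g : Carrier) → InRestrictedSumset s A g

  -- χ̂(G,[0,s]) ≥ X  (the minimum of the above set is at least X)
  ChiHat≥ : ℕ → ℕ → Set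
  ChiHat≥ s X = (m : ℕ) → ChiHatProperty s m → X ≤ m

mod : ℕ → ℕ → ℕ
mod a zero    = a
mod a (suc b) = a % suc b

quot : ℕ → ℕ → ℕ
quot a zero    = 0
quot a (suc b) = a / suc b

ceilDiv : ℕ → ℕ → ℕ
ceilDiv a zero    = 0
ceilDiv a (suc b) = (a + b) / suc b

sumFin : (t : ℕ) → (Fin t → ℕ) → ℕ
sumFin t f = sum (map f (allFin t))

prodFin : (t : ℕ) → (Fin t → ℕ) → ℕ
prodFin t f = foldr _*_ 1 (map f (allFin t))

open import Data.Nat.Divisibility using (_∣_)
open import Data.Fin using (toℕ)

IsType : (t : ℕ) → (Fin t → ℕ) → Set
IsType t d =
  (1 ≤ t) ×
  ((i : Fin t) → 2 ≤ d i) ×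
  ((i j : Fin t) → suc (toℕ i) ≡ toℕ j → d i ∣ d j)

module _ (G : FiniteAbelianGroup) where
  open FiniteAbelianGroup G

  -- φ : G → ℤ_{d_1} × ⋯ × ℤ_{d_t} is a surjective homomorphism
  -- (elements of the product are tuples v with 0 ≤ v i < d i)
  IsSurjHomToProduct : (t : ℕ) → (d : Fin t → ℕ) → (Carrier → Fin t → ℕ) → Set
  IsSurjHomToProduct t d φ =
    ((x : Carrier) (i : Fin t) → φ x i < d i) ×
    ((x y : Carrier) (i : Fin t) → φ (x +ᴳ y) i ≡ mod (φ x i + φ y i) (d i)) ×
    ((v : Fin t → ℕ) → ((i : Fin t) → v i < d i) →
       ∃[ x ] ((i : Fin t) → φ x i ≡ v i))

  IsSubgroup : (Carrier → Set) → Set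
  IsSubgroup H =
    H 0ᴳ × (∀ {x y} → H x → H y → H (x +ᴳ y)) × (∀ {x} → H x → H (-ᴳ x))

  -- G/H is of type (d_1,…,d_t): (d_i) is a type and there is a surjective
  -- homomorphism G → ℤ_{d_1}×⋯×ℤ_{d_t} whose kernel is exactly H
  -- (so G/H ≅ ℤ_{d_1}×⋯×ℤ_{d_t} by the first isomorphism theorem).
  QuotientHasType : (Carrier → Set) → (t : ℕ) → (Fin t → ℕ) → Set
  QuotientHasType H t d =
    IsType t d ×
    ∃[ φ ] (IsSurjHomToProduct t d φ ×
            ((x : Carrier) → (H x → (i : Fin t) → φ x i ≡ 0) ×
                             (((i : Fin t) → φ x i ≡ 0) → H x)))

module Submission where

-- Let φ : G → ℤ_{d_1} × ⋯ × ℤ_{d_t} be the quotient map.  Each fibre of φ is a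
-- translate of the kernel, so the kernel has K ≥ n/d elements.  Let A be the
-- union of the fibres over 0 and over k e_i for 1 ≤ k ≤ c_i; it has
-- (1 + Σ c_i) K elements, and it generates G, since an element outside the
-- kernel is a point of the fibre over e_i plus an element of smaller
-- coordinate sum.  An element of A has at most one nonzero coordinate, and
-- that coordinate i is at most c_i.  So if h elements of A sum to the element
-- with coordinates (d_i − 1)_i, their integer coordinate sums w_i satisfy
-- d_i − 1 ≤ w_i ≤ c_i N_i, where N_i counts the summands with nonzero i-th
-- coordinate and Σ N_i ≤ h; hence h ≥ Σ ⌈(d_i − 1)/c_i⌉ ≥ s + 1.

open import Defs
open import Level using (0ℓ)
open import Algebra.Bundles using (Group)
open import Algebra.Structures using (IsAbelianGroup)
import Algebra.Properties.Group as GroupProperties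
open import Data.Fin as Fin using (Fin)
open import Data.Fin.Properties as Fin using (all?; any?; ¬∀⟶∃¬)
open import Data.List using (List; []; _∷_; length; map; filter; foldr)
open import Data.List.Membership.Propositional using (_∈_)
open import Data.List.Membership.Propositional.Properties using (∈-map⁻; ∈-filter⁺; ∈-filter⁻)
open import Data.List.Properties using (length-map; map-tabulate; filter-all; length-removeAt′)
open import Data.List.Relation.Unary.All as All using (All; []; _∷_)
open import Data.List.Relation.Unary.AllPairs using (_∷_)
open import Data.List.Relation.Unary.Any using (here; there; _─_)
open import Data.List.Relation.Unary.Unique.Propositional using (Unique)
import Data.List.Relation.Unary.Unique.Propositional.Properties as Unique
open import Data.Nat using (ℕ; zero; suc; _+_; _*_; _∸_; _⊓_; _≤_; _<_; z≤n; s≤s; pred)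
  renaming (_≟_ to _≟ℕ_)
open import Data.Nat.DivMod
open import Data.Nat.Induction using (<-wellFounded)
open import Data.Nat.ListAction using (sum)
open import Data.Nat.Properties
open import Algebra.Properties.CommutativeSemigroup +-commutativeSemigroup
  using (interchange; x∙yz≈y∙xz)
open import Data.Product using (∃; ∃-syntax; _×_; _,_; proj₁; proj₂)
open import Data.Sum using (inj₁; inj₂)
open import Data.Vec.Functional using (Vector; updateAt; replicate)
  renaming ([] to []ᵛ; _∷_ to _∷ᵛ_)
open import Data.Vec.Functional.Properties using (updateAt-updates; updateAt-minimal)
open import Function using (_∘_; id; const; case_of_)
open import Function.Definitions using (Injective)
import Induction.WellFounded as WF
open import Relation.Binary.Construct.On as On using ()
open import Relation.Binary.PropositionalEquality
open import Relation.Nullary using (yes; no; ¬_; contradiction)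
open import Relation.Nullary.Decidable using (_×-dec_; _→-dec_; ¬?)
open import Relation.Unary using (Pred; Decidable; _⊆_; _∩_; _∪_; Empty)
open import Relation.Unary.Properties using (_∩?_; _∪?_; U?)

-- Arithmetic with the total mod, quot and ceilDiv

mod-≤ : ∀ m n → mod m n ≤ m
mod-≤ m zero    = ≤-refl
mod-≤ m (suc n) = m%n≤m m (suc n)

mod-< : ∀ {m n} → m < n → mod m n ≡ m
mod-< {n = suc n} = m<n⇒m%n≡m

mod-+-mod : ∀ m n o → mod (m + mod n o) o ≡ mod (m + n) o
mod-+-mod m n zero    = refl
mod-+-mod m n (suc o) = begin
  (m + n % suc o) % suc o                 ≡⟨ %-distribˡ-+ m (n % suc o) (suc o) ⟩
  (m % suc o + n % suc o % suc o) % suc o ≡⟨ cong (λ r → (m % suc o + r) % suc o) (m%n%n≡m%n n (suc o)) ⟩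
  (m % suc o + n % suc o) % suc o         ≡⟨ %-distribˡ-+ m n (suc o) ⟨
  (m + n) % suc o                         ∎
  where open ≡-Reasoning

mod-+-cancel : ∀ {n} u w e → u < n → mod (u + w) n ≡ w + e → u ≡ e
mod-+-cancel {suc n} u w e u<n eq = multiple-vanishes q u≡e+q*n
  where
  open ≡-Reasoning
  q : ℕ
  q = (u + w) / suc n
  u≡e+q*n : u ≡ e + q * suc n
  u≡e+q*n = +-cancelˡ-≡ w u _ (begin
    w + u                       ≡⟨ +-comm w u ⟩
    u + w                       ≡⟨ m≡m%n+[m/n]*n (u + w) (suc n) ⟩
    (u + w) % suc n + q * suc n ≡⟨ cong (_+ q * suc n) eq ⟩
    w + e + q * suc n           ≡⟨ +-assoc w e _ ⟩
    w + (e + q * suc n)         ∎)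
  multiple-vanishes : ∀ q → u ≡ e + q * suc n → u ≡ e
  multiple-vanishes zero    u≡ = trans u≡ (+-identityʳ e)
  multiple-vanishes (suc q) u≡ = contradiction
    (≤-trans (m≤n*m (suc n) (suc q)) (≤-trans (m≤n+m _ e) (≤-reflexive (sym u≡))))
    (<⇒≱ u<n)

ceilDiv-≤ : ∀ a b n → a ≤ b * n → ceilDiv a b ≤ n
ceilDiv-≤ a zero    n _    = z≤n
ceilDiv-≤ a (suc b) n a≤bn = ≤-pred (m<n*o⇒m/o<n (begin-strict
  a + b               ≤⟨ +-monoˡ-≤ b (≤-trans a≤bn (≤-reflexive (*-comm (suc b) n))) ⟩
  n * suc b + b       <⟨ n<1+n _ ⟩
  suc (n * suc b + b) ≡⟨ cong suc (+-comm (n * suc b) b) ⟩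
  suc n * suc b       ∎))
  where open ≤-Reasoning

quot-≤ : ∀ n d k → n ≤ d * k → quot n d ≤ k
quot-≤ n zero    k _    = z≤n
quot-≤ n (suc d) k n≤dk = begin
  n / suc d         ≤⟨ /-monoˡ-≤ (suc d) n≤dk ⟩
  suc d * k / suc d ≡⟨ cong (_/ suc d) (*-comm (suc d) k) ⟩
  k * suc d / suc d ≡⟨ m*n/n≡m k (suc d) ⟩
  k                 ∎
  where open ≤-Reasoning

-- Vectors over Fin t

sumFin-suc : ∀ t (f : Fin (suc t) → ℕ) → sumFin (suc t) f ≡ f Fin.zero + sumFin t (f ∘ Fin.suc)
sumFin-suc t f = cong (λ fs → f Fin.zero + sum fs)
  (trans (map-tabulate Fin.suc f) (sym (map-tabulate id (f ∘ Fin.suc))))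

prodFin-suc : ∀ t (f : Fin (suc t) → ℕ) → prodFin (suc t) f ≡ f Fin.zero * prodFin t (f ∘ Fin.suc)
prodFin-suc t f = cong (λ fs → f Fin.zero * foldr _*_ 1 fs)
  (trans (map-tabulate Fin.suc f) (sym (map-tabulate id (f ∘ Fin.suc))))

sumFin-zero : ∀ t (f : Fin t → ℕ) → (∀ i → f i ≡ 0) → sumFin t f ≡ 0
sumFin-zero zero    f f≡0 = refl
sumFin-zero (suc t) f f≡0 = trans (sumFin-suc t f)
  (cong₂ _+_ (f≡0 Fin.zero) (sumFin-zero t (f ∘ Fin.suc) (f≡0 ∘ Fin.suc)))

sumFin-single : ∀ t (f : Fin t → ℕ) j → (∀ i → i ≢ j → f i ≡ 0) → sumFin t f ≡ f j
sumFin-single (suc t) f Fin.zero f≡0 = trans (sumFin-suc t f)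
  (trans (cong (f Fin.zero +_) (sumFin-zero t (f ∘ Fin.suc) (λ i → f≡0 (Fin.suc i) λ ())))
         (+-identityʳ _))
sumFin-single (suc t) f (Fin.suc j) f≡0 = trans (sumFin-suc t f)
  (cong₂ _+_ (f≡0 Fin.zero λ ())
     (sumFin-single t (f ∘ Fin.suc) j λ i i≢j → f≡0 (Fin.suc i) (i≢j ∘ Fin.suc-injective)))

sumFin-+ : ∀ t (f g : Fin t → ℕ) → sumFin t (λ i → f i + g i) ≡ sumFin t f + sumFin t g
sumFin-+ zero    f g = refl
sumFin-+ (suc t) f g = begin
  sumFin (suc t) (λ i → f i + g i)
    ≡⟨ sumFin-suc t _ ⟩
  (f Fin.zero + g Fin.zero) + sumFin t (λ i → f (Fin.suc i) + g (Fin.suc i))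
    ≡⟨ cong (f Fin.zero + g Fin.zero +_) (sumFin-+ t (f ∘ Fin.suc) (g ∘ Fin.suc)) ⟩
  (f Fin.zero + g Fin.zero) + (sumFin t (f ∘ Fin.suc) + sumFin t (g ∘ Fin.suc))
    ≡⟨ interchange (f Fin.zero) _ _ _ ⟩
  (f Fin.zero + sumFin t (f ∘ Fin.suc)) + (g Fin.zero + sumFin t (g ∘ Fin.suc))
    ≡⟨ cong₂ _+_ (sumFin-suc t f) (sumFin-suc t g) ⟨
  sumFin (suc t) f + sumFin (suc t) g ∎
  where open ≡-Reasoning

sumFin-*ʳ : ∀ t (f : Fin t → ℕ) h → sumFin t f * h ≡ sumFin t (λ i → f i * h)
sumFin-*ʳ zero    f h = refl
sumFin-*ʳ (suc t) f h = begin
  sumFin (suc t) f * h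
    ≡⟨ cong (_* h) (sumFin-suc t f) ⟩
  (f Fin.zero + sumFin t (f ∘ Fin.suc)) * h
    ≡⟨ *-distribʳ-+ h (f Fin.zero) _ ⟩
  f Fin.zero * h + sumFin t (f ∘ Fin.suc) * h
    ≡⟨ cong (f Fin.zero * h +_) (sumFin-*ʳ t (f ∘ Fin.suc) h) ⟩
  f Fin.zero * h + sumFin t (λ i → f (Fin.suc i) * h)
    ≡⟨ sumFin-suc t _ ⟨
  sumFin (suc t) (λ i → f i * h) ∎
  where open ≡-Reasoning

sumFin-mono-≤ : ∀ t (f g : Fin t → ℕ) → (∀ i → f i ≤ g i) → sumFin t f ≤ sumFin t g
sumFin-mono-≤ zero    f g f≤g = z≤n
sumFin-mono-≤ (suc t) f g f≤g rewrite sumFin-suc t f | sumFin-suc t g =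
  +-mono-≤ (f≤g Fin.zero) (sumFin-mono-≤ t (f ∘ Fin.suc) (g ∘ Fin.suc) (f≤g ∘ Fin.suc))

sumFin-mono-< : ∀ t (f g : Fin t → ℕ) j → (∀ i → f i ≤ g i) → f j < g j → sumFin t f < sumFin t g
sumFin-mono-< (suc t) f g Fin.zero f≤g fj<gj rewrite sumFin-suc t f | sumFin-suc t g =
  +-mono-<-≤ fj<gj (sumFin-mono-≤ t (f ∘ Fin.suc) (g ∘ Fin.suc) (f≤g ∘ Fin.suc))
sumFin-mono-< (suc t) f g (Fin.suc j) f≤g fj<gj rewrite sumFin-suc t f | sumFin-suc t g =
  +-mono-≤-< (f≤g Fin.zero) (sumFin-mono-< t (f ∘ Fin.suc) (g ∘ Fin.suc) j (f≤g ∘ Fin.suc) fj<gj)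

updateAt-pointwise : ∀ {A : Set} {t} (P : Fin t → A → Set) (xs : Vector A t) i (f : A → A) →
  (∀ j → j ≢ i → P j (xs j)) → P i (f (xs i)) → ∀ j → P j (updateAt xs i f j)
updateAt-pointwise P xs i f P-others P-i j with j Fin.≟ i
... | yes refl = subst (P i) (sym (updateAt-updates i xs)) P-i
... | no j≢i   = subst (P j) (sym (updateAt-minimal j i xs j≢i)) (P-others j j≢i)

-- Counting the elements of a list that satisfy a decidable predicate

module _ {A : Set} where

  count : {P : Pred A 0ℓ} → Decidable P → List A → ℕ
  count P? xs = length (filter P? xs)

  count-U : ∀ xs → count U? xs ≡ length xs
  count-U xs = cong length (filter-all U? (All.universal-U xs))

  count-mono : {P Q : Pred A 0ℓ} (P? : Decidable P) (Q? : Decidable Q) →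
               P ⊆ Q → ∀ xs → count P? xs ≤ count Q? xs
  count-mono P? Q? P⊆Q []       = z≤n
  count-mono P? Q? P⊆Q (x ∷ xs) with P? x | Q? x
  ... | yes _  | yes _ = s≤s (count-mono P? Q? P⊆Q xs)
  ... | yes px | no ¬q = contradiction (P⊆Q px) ¬q
  ... | no _   | yes _ = m≤n⇒m≤1+n (count-mono P? Q? P⊆Q xs)
  ... | no _   | no _  = count-mono P? Q? P⊆Q xs

  count-∪ : {P Q : Pred A 0ℓ} (P? : Decidable P) (Q? : Decidable Q) →
            Empty (P ∩ Q) → ∀ xs → count (P? ∪? Q?) xs ≡ count P? xs + count Q? xs
  count-∪ P? Q? disjoint []       = refl
  count-∪ P? Q? disjoint (x ∷ xs) with P? x | Q? x
  ... | yes px | yes qx = contradiction (px , qx) (disjoint x)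
  ... | yes _  | no _   = cong suc (count-∪ P? Q? disjoint xs)
  ... | no _   | yes _  = trans (cong suc (count-∪ P? Q? disjoint xs)) (sym (+-suc _ _))
  ... | no _   | no _   = count-∪ P? Q? disjoint xs

  count-∅ : {P : Pred A 0ℓ} (P? : Decidable P) → Empty P → ∀ xs → count P? xs ≡ 0
  count-∅ P? empty []       = refl
  count-∅ P? empty (x ∷ xs) with P? x
  ... | yes px = contradiction px (empty x)
  ... | no _   = count-∅ P? empty xs

  ∈-─ : ∀ {x y : A} {ys} (x∈ys : x ∈ ys) → y ∈ ys → y ≢ x → y ∈ (ys ─ x∈ys)
  ∈-─ (here refl) (here refl) y≢x = contradiction refl y≢x
  ∈-─ (here refl) (there y∈)  _   = y∈
  ∈-─ (there x∈)  (here refl) _   = here refl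
  ∈-─ (there x∈)  (there y∈)  y≢x = there (∈-─ x∈ y∈ y≢x)

  Unique∧⊆⇒length-≤ : ∀ {xs ys} → Unique xs → (∀ {y} → y ∈ xs → y ∈ ys) → length xs ≤ length ys
  Unique∧⊆⇒length-≤ {[]}     _             _     = z≤n
  Unique∧⊆⇒length-≤ {x ∷ xs} {ys} (x∉xs ∷ u) xs⊆ys = begin
    suc (length xs)               ≤⟨ s≤s (Unique∧⊆⇒length-≤ u xs⊆ys─x) ⟩
    suc (length (ys ─ x∈ys))      ≡⟨ length-removeAt′ ys _ ⟨
    length ys                     ∎
    where
    open ≤-Reasoning
    x∈ys : x ∈ ys
    x∈ys = xs⊆ys (here refl)
    xs⊆ys─x : ∀ {y} → y ∈ xs → y ∈ (ys ─ x∈ys)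
    xs⊆ys─x y∈xs = ∈-─ x∈ys (xs⊆ys (there y∈xs)) λ y≡x → All.lookup x∉xs y∈xs (sym y≡x)

  count-≤-injection : {P Q : Pred A 0ℓ} (P? : Decidable P) (Q? : Decidable Q) {xs : List A} →
    Unique xs → (∀ x → x ∈ xs) → (f : A → A) → Injective _≡_ _≡_ f → (∀ {x} → P x → Q (f x)) →
    count P? xs ≤ count Q? xs
  count-≤-injection P? Q? {xs} unique complete f f-inj P⇒Qf =
    subst (_≤ count Q? xs) (length-map f (filter P? xs))
      (Unique∧⊆⇒length-≤ (Unique.map⁺ f-inj (Unique.filter⁺ P? unique)) image⊆)
    where
    image⊆ : ∀ {y} → y ∈ map f (filter P? xs) → y ∈ filter Q? xs
    image⊆ y∈ with x , x∈ , refl ← ∈-map⁻ f y∈ =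
      ∈-filter⁺ Q? (complete (f x)) (P⇒Qf (proj₂ (∈-filter⁻ P? {xs = xs} x∈)))

  count-≤-by-key : (key : A → ℕ) {D : ℕ} → (∀ x → key x < D) →
    {P : Pred A 0ℓ} (P? : Decidable P) (h : ℕ) (xs : List A) →
    (∀ a → a < D → count (P? ∩? λ x → key x ≟ℕ a) xs ≤ h) → count P? xs ≤ D * h
  count-≤-by-key key {D} key<D {P} P? h xs per-key =
    ≤-trans (count-mono P? (below? D) (λ px → px , key<D _) xs) (count-below D per-key)
    where
    below? : ∀ b → Decidable (λ x → P x × key x < b)
    below? b = P? ∩? λ x → key x <? b
    count-below : ∀ b → (∀ a → a < b → count (P? ∩? λ x → key x ≟ℕ a) xs ≤ h) →
                  count (below? b) xs ≤ b * h
    count-below zero    _      = ≤-reflexive (count-∅ (below? 0) (λ _ ()) xs)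
    count-below (suc b) per-a = begin
      count (below? (suc b)) xs
        ≤⟨ count-mono _ (below? b ∪? (P? ∩? λ x → key x ≟ℕ b))
             (λ (px , k<) → case m<1+n⇒m<n∨m≡n k< of λ
               { (inj₁ k<b) → inj₁ (px , k<b) ; (inj₂ k≡b) → inj₂ (px , k≡b) }) xs ⟩
      count (below? b ∪? (P? ∩? λ x → key x ≟ℕ b)) xs
        ≡⟨ count-∪ _ _ (λ _ ((_ , k<b) , (_ , k≡b)) → <-irrefl k≡b k<b) xs ⟩
      count (below? b) xs + count (P? ∩? λ x → key x ≟ℕ b) xs
        ≤⟨ +-mono-≤ (count-below b (λ a a<b → per-a a (m≤n⇒m≤1+n a<b))) (per-a b ≤-refl) ⟩
      b * h + h
        ≡⟨ +-comm (b * h) h ⟩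
      suc b * h ∎
      where open ≤-Reasoning

  Preimage : ∀ {t} → (A → Vector ℕ t) → Vector ℕ t → Pred A 0ℓ
  Preimage ψ v x = ∀ i → ψ x i ≡ v i

  preimage? : ∀ {t} (ψ : A → Vector ℕ t) v → Decidable (Preimage ψ v)
  preimage? ψ v x = all? λ i → ψ x i ≟ℕ v i

  count-≤-∏-preimages : ∀ t (ds : Vector ℕ t) (ψ : A → Vector ℕ t) → (∀ x i → ψ x i < ds i) →
    {P : Pred A 0ℓ} (P? : Decidable P) (h : ℕ) (xs : List A) →
    (∀ v → (∀ i → v i < ds i) → count (P? ∩? preimage? ψ v) xs ≤ h) →
    count P? xs ≤ prodFin t ds * h
  count-≤-∏-preimages zero ds ψ ψ<ds P? h xs per-v = begin
    count P? xs                       ≤⟨ count-mono P? (P? ∩? preimage? ψ []ᵛ) (_, λ ()) xs ⟩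
    count (P? ∩? preimage? ψ []ᵛ) xs  ≤⟨ per-v []ᵛ (λ ()) ⟩
    h                                 ≡⟨ +-identityʳ h ⟨
    1 * h                             ∎
    where open ≤-Reasoning
  count-≤-∏-preimages (suc t) ds ψ ψ<ds P? h xs per-v = begin
    count P? xs
      ≤⟨ count-≤-by-key (λ x → ψ x Fin.zero) (λ x → ψ<ds x Fin.zero) P? _ xs per-head ⟩
    ds Fin.zero * (prodFin t (ds ∘ Fin.suc) * h)
      ≡⟨ *-assoc (ds Fin.zero) _ h ⟨
    ds Fin.zero * prodFin t (ds ∘ Fin.suc) * h
      ≡⟨ cong (_* h) (prodFin-suc t ds) ⟨
    prodFin (suc t) ds * h ∎
    where
    open ≤-Reasoning
    per-head : ∀ a → a < ds Fin.zero →
      count (P? ∩? λ x → ψ x Fin.zero ≟ℕ a) xs ≤ prodFin t (ds ∘ Fin.suc) * h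
    per-head a a<d = count-≤-∏-preimages t (ds ∘ Fin.suc) (λ x → ψ x ∘ Fin.suc)
      (λ x → ψ<ds x ∘ Fin.suc) _ h xs λ v v<ds →
        ≤-trans (count-mono _ (P? ∩? preimage? ψ (a ∷ᵛ v))
                  (λ ((px , ψ₀≡a) , ψ₊≡v) → px , λ { Fin.zero → ψ₀≡a ; (Fin.suc i) → ψ₊≡v i }) xs)
                (per-v (a ∷ᵛ v) λ { Fin.zero → a<d ; (Fin.suc i) → v<ds i })

  count-∪-⋃ : ∀ t (R : Fin t → Pred A 0ℓ) (R? : ∀ i → Decidable (R i))
    {B : Pred A 0ℓ} (B? : Decidable B) (xs : List A) →
    (∀ i → Empty (R i ∩ B)) → (∀ i j → i ≢ j → Empty (R i ∩ R j)) →
    count B? xs + sumFin t (λ i → count (R? i) xs) ≤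
    count (B? ∪? λ x → any? λ i → R? i x) xs
  count-∪-⋃ zero R R? B? xs _ _ =
    ≤-trans (≤-reflexive (+-identityʳ _)) (count-mono B? _ inj₁ xs)
  count-∪-⋃ (suc t) R R? {B} B? xs R∩B R∩R = begin
    count B? xs + sumFin (suc t) (λ i → count (R? i) xs)
      ≡⟨ cong (count B? xs +_) (sumFin-suc t _) ⟩
    count B? xs + (count (R? Fin.zero) xs + sumFin t (λ i → count (R? (Fin.suc i)) xs))
      ≡⟨ x∙yz≈y∙xz (count B? xs) (count (R? Fin.zero) xs) _ ⟩
    count (R? Fin.zero) xs + (count B? xs + sumFin t (λ i → count (R? (Fin.suc i)) xs))
      ≤⟨ +-monoʳ-≤ _ (count-∪-⋃ t (R ∘ Fin.suc) (R? ∘ Fin.suc) B? xs (R∩B ∘ Fin.suc)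
           λ i j i≢j → R∩R (Fin.suc i) (Fin.suc j) (i≢j ∘ Fin.suc-injective)) ⟩
    count (R? Fin.zero) xs + count rest? xs
      ≡⟨ count-∪ (R? Fin.zero) rest? R₀∩rest xs ⟨
    count (R? Fin.zero ∪? rest?) xs
      ≤⟨ count-mono _ _ (λ { (inj₁ r) → inj₂ (Fin.zero , r) ; (inj₂ (inj₁ b)) → inj₁ b
                           ; (inj₂ (inj₂ (j , r))) → inj₂ (Fin.suc j , r) }) xs ⟩
    count (B? ∪? λ x → any? λ i → R? i x) xs ∎
    where
    open ≤-Reasoning
    rest? : Decidable (B ∪ λ x → ∃ λ i → R (Fin.suc i) x)
    rest? = B? ∪? λ x → any? λ i → R? (Fin.suc i) x
    R₀∩rest : Empty (R Fin.zero ∩ (B ∪ λ x → ∃ λ i → R (Fin.suc i) x))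
    R₀∩rest x (r , inj₁ b)        = R∩B Fin.zero x (r , b)
    R₀∩rest x (r , inj₂ (j , r′)) = R∩R Fin.zero (Fin.suc j) (λ ()) x (r , r′)

-- A surjective homomorphism onto ℤ_{d_1} × ⋯ × ℤ_{d_t}

module SurjectionToProduct (G : FiniteAbelianGroup) {t : ℕ} {ds : Vector ℕ t}
  {φ : FiniteAbelianGroup.Carrier G → Vector ℕ t} (φ-surjHom : IsSurjHomToProduct G t ds φ) where

  open FiniteAbelianGroup G
  open IsAbelianGroup isAbelianGroup using (identityˡ; isGroup)

  group : Group 0ℓ 0ℓ
  group = record { isGroup = isGroup }

  open GroupProperties group using (//-rightDividesˡ; ∙-cancelʳ)

  φ-< : ∀ x i → φ x i < ds i
  φ-< = proj₁ φ-surjHom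

  φ-+ : ∀ x y i → φ (x +ᴳ y) i ≡ mod (φ x i + φ y i) (ds i)
  φ-+ = proj₁ (proj₂ φ-surjHom)

  φ-surjective : ∀ v → (∀ i → v i < ds i) → ∃[ x ] Preimage φ v x
  φ-surjective = proj₂ (proj₂ φ-surjHom)

  ds-positive : ∀ i → 0 < ds i
  ds-positive i = ≤-<-trans z≤n (φ-< 0ᴳ i)

  φ-0ᴳ : ∀ i → φ 0ᴳ i ≡ 0
  φ-0ᴳ i = mod-+-cancel (φ 0ᴳ i) (φ 0ᴳ i) 0 (φ-< 0ᴳ i) (begin
    mod (φ 0ᴳ i + φ 0ᴳ i) (ds i) ≡⟨ φ-+ 0ᴳ 0ᴳ i ⟨
    φ (0ᴳ +ᴳ 0ᴳ) i               ≡⟨ cong (λ y → φ y i) (identityˡ 0ᴳ) ⟩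
    φ 0ᴳ i                       ≡⟨ +-identityʳ _ ⟨
    φ 0ᴳ i + 0                   ∎)
    where open ≡-Reasoning

  φ-− : ∀ x z i e → φ x i ≡ φ z i + e → φ (x +ᴳ -ᴳ z) i ≡ e
  φ-− x z i e φx≡ = mod-+-cancel _ (φ z i) e (φ-< _ i) (begin
    mod (φ (x +ᴳ -ᴳ z) i + φ z i) (ds i) ≡⟨ φ-+ (x +ᴳ -ᴳ z) z i ⟨
    φ ((x +ᴳ -ᴳ z) +ᴳ z) i              ≡⟨ cong (λ y → φ y i) (//-rightDividesˡ z x) ⟩
    φ x i                               ≡⟨ φx≡ ⟩
    φ z i + e                           ∎)
    where open ≡-Reasoning

  φ-sumᴳ : ∀ L i → φ (sumᴳ L) i ≡ mod (sum (map (λ x → φ x i) L)) (ds i)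
  φ-sumᴳ []      i = trans (φ-0ᴳ i) (sym (mod-< (ds-positive i)))
  φ-sumᴳ (x ∷ L) i = begin
    φ (x +ᴳ sumᴳ L) i
      ≡⟨ φ-+ x (sumᴳ L) i ⟩
    mod (φ x i + φ (sumᴳ L) i) (ds i)
      ≡⟨ cong (λ r → mod (φ x i + r) (ds i)) (φ-sumᴳ L i) ⟩
    mod (φ x i + mod (sum (map (λ y → φ y i) L)) (ds i)) (ds i)
      ≡⟨ mod-+-mod (φ x i) _ (ds i) ⟩
    mod (sum (map (λ y → φ y i) (x ∷ L))) (ds i) ∎
    where open ≡-Reasoning

  Kernel : Pred Carrier 0ℓ
  Kernel = Preimage φ (replicate t 0)

  kernel? : Decidable Kernel
  kernel? = preimage? φ (replicate t 0)

  kernelSize : ℕ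
  kernelSize = count kernel? elements

  -- Translation by a point of the fibre over v is a bijection between it and the kernel.
  fibre-size : ∀ v → (∀ i → v i < ds i) → count (preimage? φ v) elements ≡ kernelSize
  fibre-size v v<ds with a , φa≡v ← φ-surjective v v<ds = ≤-antisym fibre≤kernel kernel≤fibre
    where
    fibre≤kernel : count (preimage? φ v) elements ≤ kernelSize
    fibre≤kernel = count-≤-injection _ kernel? elements-uniq elements-compl
      (λ x → x +ᴳ -ᴳ a) (λ {x} {y} → ∙-cancelʳ (-ᴳ a) x y)
      λ {x} φx≡v i → φ-− x a i 0 (trans (φx≡v i) (trans (sym (φa≡v i)) (sym (+-identityʳ _))))
    kernel≤fibre : kernelSize ≤ count (preimage? φ v) elements
    kernel≤fibre = count-≤-injection kernel? _ elements-uniq elements-compl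
      (λ y → y +ᴳ a) (λ {x} {y} → ∙-cancelʳ a x y)
      λ {y} y∈ker i → begin
        φ (y +ᴳ a) i               ≡⟨ φ-+ y a i ⟩
        mod (φ y i + φ a i) (ds i) ≡⟨ cong₂ (λ p q → mod (p + q) (ds i)) (y∈ker i) (φa≡v i) ⟩
        mod (v i) (ds i)           ≡⟨ mod-< (v<ds i) ⟩
        v i                        ∎
      where open ≡-Reasoning

  order-≤-∏-kernelSize : order ≤ prodFin t ds * kernelSize
  order-≤-∏-kernelSize = begin
    order                          ≡⟨ count-U elements ⟨
    count U? elements              ≤⟨ count-≤-∏-preimages t ds φ φ-< U? kernelSize elements
                                        (λ v v<ds → ≤-trans (count-mono _ (preimage? φ v) proj₂ elements)
                                                            (≤-reflexive (fibre-size v v<ds))) ⟩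
    prodFin t ds * kernelSize      ∎
    where open ≤-Reasoning

  OnAxis : Fin t → Pred Carrier 0ℓ
  OnAxis i x = ∀ j → j ≢ i → φ x j ≡ 0

  onAxis? : ∀ i → Decidable (OnAxis i)
  onAxis? i x = all? λ j → ¬? (j Fin.≟ i) →-dec (φ x j ≟ℕ 0)

  AxisSegment : Fin t → ℕ → Pred Carrier 0ℓ
  AxisSegment i m x = (1 ≤ φ x i × φ x i ≤ m) × OnAxis i x

  axisSegment? : ∀ i m → Decidable (AxisSegment i m)
  axisSegment? i m x = ((1 ≤? φ x i) ×-dec (φ x i ≤? m)) ×-dec onAxis? i x

  axisVector : Fin t → ℕ → Vector ℕ t
  axisVector i k = updateAt (replicate t 0) i (const k)

  preimage-axisVector : ∀ {i k x} → Preimage φ (axisVector i k) x → φ x i ≡ k × OnAxis i x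
  preimage-axisVector {i} φx≡ =
    trans (φx≡ i) (updateAt-updates i _) , λ j j≢i → trans (φx≡ j) (updateAt-minimal j i _ j≢i)

  axisSegment-size : ∀ i m → m < ds i → m * kernelSize ≤ count (axisSegment? i m) elements
  axisSegment-size i zero    _    = z≤n
  axisSegment-size i (suc m) m<ds = begin
    kernelSize + m * kernelSize
      ≤⟨ +-mono-≤ (≤-reflexive (sym (fibre-size (axisVector i (suc m)) bounded)))
                  (axisSegment-size i m (<-trans (n<1+n m) m<ds)) ⟩
    count (preimage? φ (axisVector i (suc m))) elements + count (axisSegment? i m) elements
      ≡⟨ count-∪ _ _ disjoint elements ⟨
    count (preimage? φ (axisVector i (suc m)) ∪? axisSegment? i m) elements
      ≤⟨ count-mono _ (axisSegment? i (suc m)) extend elements ⟩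
    count (axisSegment? i (suc m)) elements ∎
    where
    open ≤-Reasoning
    bounded : ∀ j → axisVector i (suc m) j < ds j
    bounded = updateAt-pointwise (λ j a → a < ds j) _ i _ (λ j _ → ds-positive j) m<ds
    disjoint : Empty (Preimage φ (axisVector i (suc m)) ∩ AxisSegment i m)
    disjoint x (φx≡ , (_ , φxi≤m) , _) =
      1+n≰n (subst (_≤ m) (proj₁ (preimage-axisVector φx≡)) φxi≤m)
    extend : Preimage φ (axisVector i (suc m)) ∪ AxisSegment i m ⊆ AxisSegment i (suc m)
    extend (inj₁ φx≡) with φxi≡ , onAxis ← preimage-axisVector φx≡ =
      (subst (1 ≤_) (sym φxi≡) (s≤s z≤n) , ≤-reflexive φxi≡) , onAxis
    extend (inj₂ ((1≤φxi , φxi≤m) , onAxis)) = (1≤φxi , m≤n⇒m≤1+n φxi≤m) , onAxis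

  quot-order-≤-kernelSize : quot order (prodFin t ds) ≤ kernelSize
  quot-order-≤-kernelSize = quot-≤ order (prodFin t ds) kernelSize order-≤-∏-kernelSize

  module _ (c : Vector ℕ t) (c-bounds : ∀ i → 1 ≤ c i × c i < ds i) where

    InA : Pred Carrier 0ℓ
    InA = Kernel ∪ λ x → ∃ λ i → AxisSegment i (c i) x

    inA? : Decidable InA
    inA? = kernel? ∪? λ x → any? λ i → axisSegment? i (c i) x

    A : List Carrier
    A = filter inA? elements

    A-unique : Unique A
    A-unique = Unique.filter⁺ inA? elements-uniq

    A-size : (1 + sumFin t c) * kernelSize ≤ length A
    A-size = begin
      (1 + sumFin t c) * kernelSize
        ≡⟨ cong (kernelSize +_) (sumFin-*ʳ t c kernelSize) ⟩
      kernelSize + sumFin t (λ i → c i * kernelSize)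
        ≤⟨ +-monoʳ-≤ kernelSize (sumFin-mono-≤ t _ _ λ i → axisSegment-size i (c i) (proj₂ (c-bounds i))) ⟩
      kernelSize + sumFin t (λ i → count (axisSegment? i (c i)) elements)
        ≤⟨ count-∪-⋃ t _ _ kernel? elements segment∩kernel segment∩segment ⟩
      length A ∎
      where
      open ≤-Reasoning
      segment∩kernel : ∀ i → Empty (AxisSegment i (c i) ∩ Kernel)
      segment∩kernel i x (((1≤φxi , _) , _) , x∈ker) = contradiction (subst (1 ≤_) (x∈ker i) 1≤φxi) λ ()
      segment∩segment : ∀ i j → i ≢ j → Empty (AxisSegment i (c i) ∩ AxisSegment j (c j))
      segment∩segment i j i≢j x ((_ , onAxis-i) , ((1≤φxj , _) , _)) =
        contradiction (subst (1 ≤_) (onAxis-i j (i≢j ∘ sym)) 1≤φxj) λ ()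

    coordinateSum : Carrier → ℕ
    coordinateSum x = sumFin t (φ x)

    lower-coordinate : ∀ x i k → φ x i ≡ suc k →
              ∃[ z ] (InA (x +ᴳ -ᴳ z) × coordinateSum z < coordinateSum x)
    lower-coordinate x i k φxi≡ = z , inj₂ (i , (1≤φyi , φyi≤ci) , φy-off-i) , smaller
      where
      lowered< : ∀ j → updateAt (φ x) i pred j < ds j
      lowered< = updateAt-pointwise (λ j a → a < ds j) (φ x) i pred
                   (λ j _ → φ-< x j) (≤-<-trans pred[n]≤n (φ-< x i))
      z : Carrier
      z = proj₁ (φ-surjective _ lowered<)
      φz≡ : Preimage φ (updateAt (φ x) i pred) z
      φz≡ = proj₂ (φ-surjective _ lowered<)
      φzi≡k : φ z i ≡ k
      φzi≡k = trans (φz≡ i) (trans (updateAt-updates i (φ x)) (cong pred φxi≡))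
      φyi≡1 : φ (x +ᴳ -ᴳ z) i ≡ 1
      φyi≡1 = φ-− x z i 1 (trans φxi≡ (trans (+-comm 1 k) (cong (_+ 1) (sym φzi≡k))))
      1≤φyi : 1 ≤ φ (x +ᴳ -ᴳ z) i
      1≤φyi = ≤-reflexive (sym φyi≡1)
      φyi≤ci : φ (x +ᴳ -ᴳ z) i ≤ c i
      φyi≤ci = subst (_≤ c i) (sym φyi≡1) (proj₁ (c-bounds i))
      φy-off-i : OnAxis i (x +ᴳ -ᴳ z)
      φy-off-i j j≢i = φ-− x z j 0
        (trans (sym (trans (φz≡ j) (updateAt-minimal j i (φ x) j≢i))) (sym (+-identityʳ _)))
      φz≤φx : ∀ j → φ z j ≤ φ x j
      φz≤φx j = subst (_≤ φ x j) (sym (φz≡ j))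
        (updateAt-pointwise (λ j a → a ≤ φ x j) (φ x) i pred (λ _ _ → ≤-refl) pred[n]≤n j)
      smaller : coordinateSum z < coordinateSum x
      smaller = sumFin-mono-< t (φ z) (φ x) i φz≤φx (subst₂ _<_ (sym φzi≡k) (sym φxi≡) (n<1+n k))

    A-generates : Generates A
    A-generates = WF.All.wfRec (On.wellFounded coordinateSum <-wellFounded) 0ℓ (InGenerated A) step
      where
      ∈A : ∀ {x} → InA x → x ∈ A
      ∈A {x} = ∈-filter⁺ inA? (elements-compl x)
      step : ∀ x → (∀ {z} → coordinateSum z < coordinateSum x → InGenerated A z) → InGenerated A x
      step x ih with kernel? x
      ... | yes x∈ker = gen (∈A (inj₁ x∈ker))
      ... | no x∉ker with i , φxi≢0 ← ¬∀⟶∃¬ t _ (λ i → φ x i ≟ℕ 0) x∉ker with φ x i in φxi≡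
      ...   | zero  = contradiction refl φxi≢0
      ...   | suc k with z , y∈A , smaller ← lower-coordinate x i k φxi≡ =
        subst (InGenerated A) (//-rightDividesˡ z x) (gen+ (gen (∈A y∈A)) (ih smaller))

    coordinate-≤ : ∀ {x} → InA x → ∀ i → φ x i ≤ c i * (1 ⊓ φ x i)
    coordinate-≤ {x} x∈A i with φ x i in φxi≡
    ... | zero  = z≤n
    ... | suc k with x∈A
    ...   | inj₁ x∈ker = contradiction (trans (sym (x∈ker i)) φxi≡) λ ()
    ...   | inj₂ (j , (_ , φxj≤cj) , onAxis) with i Fin.≟ j
    ...     | yes refl = subst (_≤ c i * 1) φxi≡ (subst (φ x i ≤_) (sym (*-identityʳ (c i))) φxj≤cj)
    ...     | no i≢j   = contradiction (trans (sym (onAxis i i≢j)) φxi≡) λ ()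

    support-≤1 : ∀ {x} → InA x → sumFin t (λ i → 1 ⊓ φ x i) ≤ 1
    support-≤1 (inj₁ x∈ker) = ≤-trans (≤-reflexive (sumFin-zero t _ λ i → cong (1 ⊓_) (x∈ker i))) z≤n
    support-≤1 (inj₂ (j , _ , onAxis)) =
      ≤-trans (≤-reflexive (sumFin-single t _ j λ i i≢j → cong (1 ⊓_) (onAxis i i≢j))) (m⊓n≤m 1 _)

    coordinateSum-≤ : ∀ {L} → All InA L → ∀ i →
      sum (map (λ x → φ x i) L) ≤ c i * sum (map (λ x → 1 ⊓ φ x i) L)
    coordinateSum-≤ []              i = z≤n
    coordinateSum-≤ {x ∷ L} (x∈A ∷ L⊆A) i =
      ≤-trans (+-mono-≤ (coordinate-≤ x∈A i) (coordinateSum-≤ L⊆A i))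
              (≤-reflexive (sym (*-distribˡ-+ (c i) (1 ⊓ φ x i) _)))

    total-support-≤ : ∀ {L} → All InA L → sumFin t (λ i → sum (map (λ x → 1 ⊓ φ x i) L)) ≤ length L
    total-support-≤ []                  = ≤-reflexive (sumFin-zero t _ λ _ → refl)
    total-support-≤ {x ∷ L} (x∈A ∷ L⊆A) =
      ≤-trans (≤-reflexive (sumFin-+ t (λ i → 1 ⊓ φ x i) _))
              (+-mono-≤ (support-≤1 x∈A) (total-support-≤ L⊆A))

    corner∉[0,s]A : ∀ s g → (∀ i → φ g i ≡ ds i ∸ 1) →
      s + 1 ≤ sumFin t (λ i → ceilDiv (ds i ∸ 1) (c i)) → ¬ InRestrictedSumset s A g
    corner∉[0,s]A s g φg≡ s<Σ (h , h≤s , L , |L|≡h , L∈A , ΣL≡g) = 1+n≰n (begin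
      suc s                                          ≡⟨ +-comm 1 s ⟩
      s + 1                                          ≤⟨ s<Σ ⟩
      sumFin t (λ i → ceilDiv (ds i ∸ 1) (c i))      ≤⟨ sumFin-mono-≤ t _ _ ceil≤support ⟩
      sumFin t (λ i → sum (map (λ x → 1 ⊓ φ x i) L)) ≤⟨ total-support-≤ L⊆A ⟩
      length L                                       ≡⟨ |L|≡h ⟩
      h                                              ≤⟨ h≤s ⟩
      s                                              ∎)
      where
      open ≤-Reasoning
      L⊆A : All InA L
      L⊆A = All.map (λ x∈A → proj₂ (∈-filter⁻ inA? {xs = elements} x∈A)) L∈A
      corner≤coordinateSum : ∀ i → ds i ∸ 1 ≤ sum (map (λ x → φ x i) L)
      corner≤coordinateSum i =
        subst (_≤ _) (trans (sym (φ-sumᴳ L i)) (trans (cong (λ y → φ y i) ΣL≡g) (φg≡ i))) (mod-≤ _ (ds i))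
      ceil≤support : ∀ i → ceilDiv (ds i ∸ 1) (c i) ≤ sum (map (λ x → 1 ⊓ φ x i) L)
      ceil≤support i = ceilDiv-≤ _ (c i) _ (≤-trans (corner≤coordinateSum i) (coordinateSum-≤ L⊆A i))

-- H is used only through φ, whose kernel it is.
proposition8 : (G : FiniteAbelianGroup) (s : ℕ) → 1 ≤ s →
    (H : FiniteAbelianGroup.Carrier G → Set) → IsSubgroup G H →
    (t : ℕ) (ds : Fin t → ℕ) → QuotientHasType G H t ds →
    (d : ℕ) → d ≡ prodFin t ds → 1 < d →
    (c : Fin t → ℕ) → ((i : Fin t) → 1 ≤ c i × c i ≤ ds i ∸ 1) →
    s + 1 ≤ sumFin t (λ i → ceilDiv (ds i ∸ 1) (c i)) →
    FiniteAbelianGroup.ChiHat≥ G s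
      ((1 + sumFin t c) * quot (FiniteAbelianGroup.order G) d + 1)
proposition8 G s _ _ _ t ds (_ , φ , φ-surjHom , _) d refl _ c c-bounds s<Σ m m-works =
  ≮⇒≥ λ m<bound → corner∉[0,s]A c c<ds s corner φcorner≡ s<Σ
    (m-works (A c c<ds) (A-unique c c<ds) (A-generates c c<ds) (m≤|A| m<bound) corner)
  where
  open FiniteAbelianGroup G using (order)
  open SurjectionToProduct G φ-surjHom
  ds∸1<ds : ∀ i → ds i ∸ 1 < ds i
  ds∸1<ds i = ∸-monoʳ-< (s≤s z≤n) (ds-positive i)
  c<ds : ∀ i → 1 ≤ c i × c i < ds i
  c<ds i = proj₁ (c-bounds i) , ≤-<-trans (proj₂ (c-bounds i)) (ds∸1<ds i)
  corner : FiniteAbelianGroup.Carrier G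
  corner = proj₁ (φ-surjective (λ i → ds i ∸ 1) ds∸1<ds)
  φcorner≡ : ∀ i → φ corner i ≡ ds i ∸ 1
  φcorner≡ = proj₂ (φ-surjective (λ i → ds i ∸ 1) ds∸1<ds)
  m≤|A| : m < (1 + sumFin t c) * quot order d + 1 → m ≤ length (A c c<ds)
  m≤|A| m<bound = begin
    m                                            ≤⟨ m<1+n⇒m≤n (subst (m <_) (+-comm _ 1) m<bound) ⟩
    (1 + sumFin t c) * quot order (prodFin t ds) ≤⟨ *-monoʳ-≤ (1 + sumFin t c) quot-order-≤-kernelSize ⟩
    (1 + sumFin t c) * kernelSize                ≤⟨ A-size c c<ds ⟩
    length (A c c<ds)                            ∎
    where open ≤-Reasoning
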